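{- Let $G=G[X_1,X_2]$ be a simple bipartite graph with parts $X_1,X_2$ on $n\ge 4$ vertices such that $|X_1|>|X_2|+1$ and every vertex of $X_2$ has degree at least $\tfrac12 n+1$. Then any two distinct vertices $x_1,x_2\in X_1$ with $d(x_1),d(x_2)\ge 2$ are joined by a path which visits every vertex of $X_2$. -}

module Defs where

open import Data.Nat using (ℕ; zero; suc; _+_)
open import Data.Bool using (Bool; true; false; T; not)
open import Data.Fin using (Fin)
open import Data.List using (List; []; _∷_; head; last; filter; length; allFin)
open import Data.Maybe using (Maybe; just)
open import Data.List.Relation.Unary.Unique.Propositional using (Unique)
open import Data.List.Membership.Propositional using (_∈_)
open import Relation.Binary.PropositionalEquality using (_≡_)
open import Relation.Nullary using (¬_)
open import Relation.Nullary.Decidable using (does)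
open import Data.Bool.Properties using (T?)

record SimpleGraph (n : ℕ) : Set where
  field
    adj   : Fin n → Fin n → Bool
    sym   : ∀ u v → adj u v ≡ adj v u
    loopless : ∀ v → adj v v ≡ false

open SimpleGraph public

Adj : ∀ {n} → SimpleGraph n → Fin n → Fin n → Set
Adj G u v = T (adj G u v)

degree : ∀ {n} → SimpleGraph n → Fin n → ℕ
degree {n} G v = length (filter (λ u → T? (adj G v u)) (allFin n))

-- A bipartition: side v ≡ false means v ∈ X₁, side v ≡ true means v ∈ X₂.
-- G is bipartite with respect to it if every edge joins the two parts.
IsBipartition : ∀ {n} → SimpleGraph n → (Fin n → Bool) → Set
IsBipartition G side = ∀ u v → Adj G u v → side u ≡ not (side v)

partSize : ∀ {n} → (Fin n → Bool) → Bool → ℕ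
partSize {n} side b = length (filter (λ v → T? (does (side v Data.Bool.≟ b))) (allFin n))

data Walk {n} (G : SimpleGraph n) : List (Fin n) → Set where
  single : ∀ v → Walk G (v ∷ [])
  step   : ∀ u v vs → Adj G u v → Walk G (v ∷ vs) → Walk G (u ∷ v ∷ vs)

record IsPath {n} (G : SimpleGraph n) (x y : Fin n) (p : List (Fin n)) : Set where
  field
    walk     : Walk G p
    distinct : Unique p
    start    : head p ≡ just x
    end      : last p ≡ just y

-- Two vertices u, v of X₂ satisfy d(u) + d(v) ≥ n + 2 while N(u) ∪ N(v) ⊆ X₁, so by
-- inclusion–exclusion they have at least |X₂| + 2 common neighbours. A path running from
-- X₂ to x₂ ∈ X₁ alternates sides, hence contains as many X₁- as X₂-vertices, at most |X₂|.
-- So such a path, together with x₁, blocks at most |X₂| + 1 of those common neighbours, and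
-- any new vertex m ∈ X₂ can be prepended through a fresh common neighbour of m and the
-- current head. Grow the path backwards from x₂ through a neighbour y₂ of x₂, absorbing all
-- of X₂ and ending at a neighbour y₁ ≠ y₂ of x₁; then prepend x₁.
module Submission where

open import Defs renaming (sym to adj-sym)

open import Data.Bool using (Bool; true; false; not; T) renaming (_≟_ to _≟ᵇ_)
open import Data.Bool.Properties using (T?; not-involutive)
open import Data.Empty using (⊥-elim)
open import Data.Fin using (Fin) renaming (_≟_ to _≟ᶠ_)
open import Data.List using (List; []; _∷_; _++_; [_]; filter; length; allFin; last)
open import Data.List.Properties
  using (filter-all; filter-none; filter-accept; filter-≐; length-tabulate)
open import Data.List.Membership.Propositional using (_∈_; _∉_; find)
open import Data.List.Membership.Propositional.Properties
  using (∈-allFin; ∈-filter⁺; ∈-filter⁻; ∈-∃++; ∈-++⁺ˡ; ∈-++⁺ʳ; ∈-++⁻)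
open import Data.List.Relation.Unary.All as All using (All; []; _∷_; all?)
open import Data.List.Relation.Unary.All.Properties using (¬Any⇒All¬; ¬All⇒Any¬; all-filter)
open import Data.List.Relation.Unary.Any using (here; there)
open import Data.List.Relation.Unary.AllPairs using ([]; _∷_)
open import Data.List.Relation.Unary.Unique.Propositional using (Unique)
open import Data.List.Relation.Unary.Unique.Propositional.Properties using (allFin⁺; filter⁺)
open import Data.List.Relation.Binary.Subset.Propositional using (_⊆_)
open import Data.List.Relation.Binary.Subset.Propositional.Properties using (filter⁺′)
open import Data.List.Relation.Binary.Permutation.Propositional.Properties using (↭-length; shift)
import Data.List.Relation.Binary.Sublist.Propositional as Sublist
import Data.List.Relation.Binary.Sublist.Propositional.Properties as Sublistₚ
open import Data.Maybe using (just)
open import Data.Nat using (ℕ; suc; _+_; _*_; _≤_; _<_; z≤n; s≤s)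
open import Data.Nat.Properties
open import Data.Product using (Σ; ∃-syntax; _×_; _,_; proj₂)
open import Data.Sum using (_⊎_; inj₁; inj₂)
open import Function using (id; _∘_)
open import Relation.Binary.Definitions using (DecidableEquality)
open import Relation.Binary.PropositionalEquality
  using (_≡_; _≢_; refl; sym; trans; cong; cong₂; subst; module ≡-Reasoning)
open import Relation.Nullary using (¬_; yes; no; does; _×-dec_; ¬?)
open import Relation.Nullary.Decidable using (toWitness; fromWitness; isYes≗does)
open import Relation.Unary using (Pred; Decidable)
open import Relation.Unary.Properties using (_∪?_; _∩?_)

module _ {a} {A : Set a} where

  ∉-∷ : ∀ {x y : A} {ys} → x ≢ y → x ∉ ys → x ∉ y ∷ ys
  ∉-∷ x≢y _    (here x≡y)   = x≢y x≡y
  ∉-∷ _   x∉ys (there x∈ys) = x∉ys x∈ys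

  Unique-⊆⇒length-≤ : {xs ys : List A} → Unique xs → xs ⊆ ys → length xs ≤ length ys
  Unique-⊆⇒length-≤ [] _ = z≤n
  Unique-⊆⇒length-≤ {x ∷ xs} (x∉xs ∷ !xs) xs⊆ys
    with us , vs , refl ← ∈-∃++ (xs⊆ys (here refl)) = begin
      suc (length xs)            ≤⟨ s≤s (Unique-⊆⇒length-≤ !xs xs⊆us++vs) ⟩
      suc (length (us ++ vs))    ≡⟨ ↭-length (shift x us vs) ⟨
      length (us ++ [ x ] ++ vs) ∎
    where
    open ≤-Reasoning
    xs⊆us++vs : xs ⊆ us ++ vs
    xs⊆us++vs y∈xs with ∈-++⁻ us (xs⊆ys (there y∈xs))
    ... | inj₁ y∈us         = ∈-++⁺ˡ y∈us
    ... | inj₂ (here refl)  = ⊥-elim (All.lookup x∉xs y∈xs refl)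
    ... | inj₂ (there y∈vs) = ∈-++⁺ʳ us y∈vs

  module _ (_≟_ : DecidableEquality A) where

    open import Data.List.Membership.DecPropositional _≟_ using (_∈?_)

    length-<⇒∃-∉ : {xs ys : List A} → Unique xs → length ys < length xs →
                   ∃[ x ] x ∈ xs × x ∉ ys
    length-<⇒∃-∉ {xs} {ys} !xs ys<xs with all? (_∈? ys) xs
    ... | yes xs⊆ys = ⊥-elim (<⇒≱ ys<xs (Unique-⊆⇒length-≤ !xs (All.lookup xs⊆ys)))
    ... | no xs⊈ys  = find (¬All⇒Any¬ (_∈? ys) xs xs⊈ys)

  module _ {p q} {P : Pred A p} {Q : Pred A q} (P? : Decidable P) (Q? : Decidable Q) where

    length-filter-mono : (∀ {x} → P x → Q x) →
                         ∀ xs → length (filter P? xs) ≤ length (filter Q? xs)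
    length-filter-mono P⇒Q xs =
      Sublistₚ.length-mono-≤ (Sublistₚ.filter⁺ P? Q? (λ { refl → P⇒Q }) (Sublist.⊆-refl {x = xs}))

    length-filter-∪-∩ : ∀ xs → length (filter P? xs) + length (filter Q? xs) ≡
                               length (filter (P? ∪? Q?) xs) + length (filter (P? ∩? Q?) xs)
    length-filter-∪-∩ [] = refl
    length-filter-∪-∩ (x ∷ xs) with does (P? x) | does (Q? x)
    ... | true  | true  =
      cong suc (trans (+-suc _ _) (trans (cong suc (length-filter-∪-∩ xs)) (sym (+-suc _ _))))
    ... | true  | false = cong suc (length-filter-∪-∩ xs)
    ... | false | true  = trans (+-suc _ _) (cong suc (length-filter-∪-∩ xs))
    ... | false | false = length-filter-∪-∩ xs

m≤2*a⇒m≤2*b⇒m≤a+b : ∀ {m a b} → m ≤ 2 * a → m ≤ 2 * b → m ≤ a + b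
m≤2*a⇒m≤2*b⇒m≤a+b {m} {a} {b} m≤2a m≤2b = *-cancelˡ-≤ 2 (begin
  2 * m          ≡⟨ cong (m +_) (+-identityʳ m) ⟩
  m + m          ≤⟨ +-mono-≤ m≤2a m≤2b ⟩
  2 * a + 2 * b  ≡⟨ *-distribˡ-+ 2 a b ⟨
  2 * (a + b)    ∎)
  where open ≤-Reasoning

IsPath-∷ : ∀ {n} {G : SimpleGraph n} {u h y tl} → Adj G u h → u ∉ h ∷ tl →
           IsPath G h y (h ∷ tl) → IsPath G u y (u ∷ h ∷ tl)
IsPath-∷ u~h u∉ p = record
  { walk     = step _ _ _ u~h (IsPath.walk p)
  ; distinct = ¬Any⇒All¬ _ u∉ ∷ IsPath.distinct p
  ; start    = refl
  ; end      = IsPath.end p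
  }

module Neighbours {n} (G : SimpleGraph n) where

  Adj-sym : ∀ {u v} → Adj G u v → Adj G v u
  Adj-sym {u} {v} = subst T (adj-sym G u v)

  N? : (u : Fin n) → Decidable (Adj G u)
  N? u w = T? (adj G u w)

  commonNeighbours : Fin n → Fin n → List (Fin n)
  commonNeighbours u v = filter (N? u ∩? N? v) (allFin n)

  neighbour-∉ : ∀ {v} {ys : List (Fin n)} → length ys < degree G v → ∃[ w ] Adj G v w × w ∉ ys
  neighbour-∉ {v} ys<deg
    with w , w∈N , w∉ys ← length-<⇒∃-∉ _≟ᶠ_ (filter⁺ (N? v) (allFin⁺ n)) ys<deg =
    w , proj₂ (∈-filter⁻ (N? v) {xs = allFin n} w∈N) , w∉ys

module Bipartite {n} (G : SimpleGraph n) (side : Fin n → Bool)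
                 (bipartite : IsBipartition G side) where

  open Neighbours G

  V : Set
  V = Fin n

  neighbour-side : ∀ {u w b} → Adj G u w → side u ≡ b → side w ≡ not b
  neighbour-side {u} {w} u~w refl =
    trans (sym (not-involutive (side w))) (cong not (sym (bipartite u w u~w)))

  X₂≢X₁ : ∀ {u v} → side u ≡ true → side v ≡ false → u ≢ v
  X₂≢X₁ u∈X₂ v∈X₁ refl with trans (sym u∈X₂) v∈X₁
  ... | ()

  X? : (b : Bool) → Decidable (λ v → side v ≡ b)
  X? b v = side v ≟ᵇ b

  count : Bool → List V → ℕ
  count b xs = length (filter (X? b) xs)

  partSize≡count : ∀ b → partSize side b ≡ count b (allFin n)
  partSize≡count b =
    cong length (filter-≐ (λ v → T? (does (side v ≟ᵇ b))) (X? b) (sound , complete) (allFin n))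
    where
    sound : ∀ {v} → T (does (side v ≟ᵇ b)) → side v ≡ b
    sound {v} t = toWitness (subst T (sym (isYes≗does (side v ≟ᵇ b))) t)
    complete : ∀ {v} → side v ≡ b → T (does (side v ≟ᵇ b))
    complete {v} e = subst T (isYes≗does (side v ≟ᵇ b)) (fromWitness e)

  partSize-+ : partSize side false + partSize side true ≡ n
  partSize-+ = begin
    partSize side false + partSize side true
      ≡⟨ cong₂ _+_ (partSize≡count false) (partSize≡count true) ⟩
    count false (allFin n) + count true (allFin n)
      ≡⟨ length-filter-∪-∩ (X? false) (X? true) (allFin n) ⟩
    length (filter (X? false ∪? X? true) (allFin n)) + length (filter (X? false ∩? X? true) (allFin n))
      ≡⟨ cong₂ (λ xs ys → length xs + length ys)
               (filter-all (X? false ∪? X? true) (All.universal some-side (allFin n)))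
               (filter-none (X? false ∩? X? true) (All.universal no-two-sides (allFin n))) ⟩
    length (allFin n) + 0
      ≡⟨ trans (+-identityʳ _) (length-tabulate id) ⟩
    n ∎
    where
    open ≡-Reasoning
    some-side : ∀ v → side v ≡ false ⊎ side v ≡ true
    some-side v with side v
    ... | false = inj₁ refl
    ... | true  = inj₂ refl
    no-two-sides : ∀ v → ¬ (side v ≡ false × side v ≡ true)
    no-two-sides v (v∈X₁ , v∈X₂) = X₂≢X₁ v∈X₂ v∈X₁ refl

  count-≤-partSize : ∀ b {xs} → Unique xs → count b xs ≤ partSize side b
  count-≤-partSize b {xs} !xs = subst (count b xs ≤_) (sym (partSize≡count b))
    (Unique-⊆⇒length-≤ (filter⁺ (X? b) !xs) (filter⁺′ (X? b) (X? b) id {xs} (λ {v} _ → ∈-allFin v)))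

  count-edge : ∀ b {v w} xs → side v ≡ true → side w ≡ false →
               count b (v ∷ w ∷ xs) ≡ suc (count b xs)
  count-edge false xs v∈X₂ w∈X₁ rewrite v∈X₂ | w∈X₁ = refl
  count-edge true  xs v∈X₂ w∈X₁ rewrite v∈X₂ | w∈X₁ = refl

  walk-balanced : ∀ {v vs x} → Walk G (v ∷ vs) → side v ≡ true →
                  last (v ∷ vs) ≡ just x → side x ≡ false →
                  count false (v ∷ vs) ≡ count true (v ∷ vs)
  walk-balanced (single v) v∈X₂ refl v∈X₁ = ⊥-elim (X₂≢X₁ v∈X₂ v∈X₁ refl)
  walk-balanced (step v w ws v~w w-walk) v∈X₂ end x∈X₁ = begin
    count false (v ∷ w ∷ ws)  ≡⟨ count-edge false ws v∈X₂ w∈X₁ ⟩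
    suc (count false ws)      ≡⟨ cong suc (rest-balanced ws w-walk end) ⟩
    suc (count true ws)       ≡⟨ count-edge true ws v∈X₂ w∈X₁ ⟨
    count true (v ∷ w ∷ ws)   ∎
    where
    open ≡-Reasoning
    w∈X₁ : side w ≡ false
    w∈X₁ = neighbour-side v~w v∈X₂
    rest-balanced : ∀ ws → Walk G (w ∷ ws) → last (w ∷ ws) ≡ just _ →
                    count false ws ≡ count true ws
    rest-balanced []       _                       _   = refl
    rest-balanced (u ∷ us) (step _ _ _ w~u u-walk) end =
      walk-balanced u-walk (neighbour-side w~u w∈X₁) end x∈X₁

  module _ (dense : ∀ v → side v ≡ true → n + 2 ≤ 2 * degree G v) where

    many-common-neighbours : ∀ {u v} → side u ≡ true → side v ≡ true →
                             2 + partSize side true ≤ length (commonNeighbours u v)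
    many-common-neighbours {u} {v} u∈X₂ v∈X₂ = +-cancelˡ-≤ A _ _ (begin
      A + (2 + B)              ≡⟨ cong (A +_) (+-comm 2 B) ⟩
      A + (B + 2)              ≡⟨ +-assoc A B 2 ⟨
      A + B + 2                ≡⟨ cong (_+ 2) partSize-+ ⟩
      n + 2                    ≤⟨ m≤2*a⇒m≤2*b⇒m≤a+b {a = degree G u} (dense u u∈X₂) (dense v v∈X₂) ⟩
      degree G u + degree G v  ≡⟨ length-filter-∪-∩ (N? u) (N? v) (allFin n) ⟩
      U + C                    ≤⟨ +-monoˡ-≤ C U≤A ⟩
      A + C                    ∎)
      where
      open ≤-Reasoning
      A = partSize side false
      B = partSize side true
      C = length (commonNeighbours u v)
      U = length (filter (N? u ∪? N? v) (allFin n))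
      in-X₁ : ∀ {w} → Adj G u w ⊎ Adj G v w → side w ≡ false
      in-X₁ (inj₁ u~w) = neighbour-side u~w u∈X₂
      in-X₁ (inj₂ v~w) = neighbour-side v~w v∈X₂
      U≤A : U ≤ A
      U≤A = begin
        U                       ≤⟨ length-filter-mono (N? u ∪? N? v) (X? false) in-X₁ (allFin n) ⟩
        count false (allFin n)  ≡⟨ partSize≡count false ⟨
        A                       ∎

    fresh-common-neighbour : ∀ {u v} → side u ≡ true → side v ≡ true → (F : List V) →
                             count false F ≤ 1 + partSize side true →
                             ∃[ w ] Adj G u w × Adj G v w × w ∉ F
    fresh-common-neighbour {u} {v} u∈X₂ v∈X₂ F F-small
      with w , w∈C , w∉F∩X₁ ← length-<⇒∃-∉ _≟ᶠ_ (filter⁺ (N? u ∩? N? v) (allFin⁺ n))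
                                 (≤-trans (s≤s F-small) (many-common-neighbours u∈X₂ v∈X₂))
      with u~w , v~w ← proj₂ (∈-filter⁻ (N? u ∩? N? v) {xs = allFin n} w∈C)
      = w , u~w , v~w , λ w∈F → w∉F∩X₁ (∈-filter⁺ (X? false) w∈F (neighbour-side u~w u∈X₂))

    module _ (x₁ x₂ : V) (x₁∈X₁ : side x₁ ≡ false) (x₂∈X₁ : side x₂ ≡ false) where

      open import Data.List.Membership.DecPropositional (_≟ᶠ_ {n}) using (_∈?_)

      record Tail (h : V) (tl : List V) : Set where
        field
          isPath  : IsPath G h x₂ (h ∷ tl)
          head∈X₂ : side h ≡ true
          x₁∉     : x₁ ∉ h ∷ tl
      open Tail

      Tail-start : ∀ {y} → Adj G x₂ y → x₁ ≢ x₂ → Tail y (x₂ ∷ [])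
      Tail-start {y} x₂~y x₁≢x₂ = record
        { isPath  = IsPath-∷ (Adj-sym x₂~y) (∉-∷ (X₂≢X₁ y∈X₂ x₂∈X₁) λ ()) x₂-path
        ; head∈X₂ = y∈X₂
        ; x₁∉     = ∉-∷ (X₂≢X₁ y∈X₂ x₁∈X₁ ∘ sym) (∉-∷ x₁≢x₂ λ ())
        }
        where
        y∈X₂ : side y ≡ true
        y∈X₂ = neighbour-side x₂~y x₂∈X₁
        x₂-path : IsPath G x₂ x₂ (x₂ ∷ [])
        x₂-path = record { walk = single x₂ ; distinct = [] ∷ [] ; start = refl ; end = refl }

      Tail-few-X₁ : ∀ {h tl} → Tail h tl → count false (x₁ ∷ h ∷ tl) ≤ 1 + partSize side true
      Tail-few-X₁ {h} {tl} t = begin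
        count false (x₁ ∷ h ∷ tl)   ≡⟨ cong length (filter-accept (X? false) x₁∈X₁) ⟩
        suc (count false (h ∷ tl))  ≡⟨ cong suc (walk-balanced walk (head∈X₂ t) end x₂∈X₁) ⟩
        suc (count true (h ∷ tl))   ≤⟨ s≤s (count-≤-partSize true distinct) ⟩
        1 + partSize side true      ∎
        where
        open ≤-Reasoning
        open IsPath (isPath t)

      Tail-prepend : ∀ {h tl m w} → Tail h tl → side m ≡ true → m ∉ h ∷ tl →
                     Adj G m w → Adj G h w → w ∉ x₁ ∷ h ∷ tl → Tail m (w ∷ h ∷ tl)
      Tail-prepend {h} {tl} {m} {w} t m∈X₂ m∉ m~w h~w w∉ = record
        { isPath  = IsPath-∷ m~w (∉-∷ (X₂≢X₁ m∈X₂ (neighbour-side m~w m∈X₂)) m∉)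
                      (IsPath-∷ (Adj-sym h~w) (w∉ ∘ there) (isPath t))
        ; head∈X₂ = m∈X₂
        ; x₁∉     = ∉-∷ (X₂≢X₁ m∈X₂ x₁∈X₁ ∘ sym) (∉-∷ (w∉ ∘ here ∘ sym) (x₁∉ t))
        }

      extend : ∀ {h tl m} → Tail h tl → side m ≡ true → m ∉ h ∷ tl →
               ∃[ w ] side w ≡ false × Tail m (w ∷ h ∷ tl)
      extend {h} {tl} t m∈X₂ m∉
        with w , m~w , h~w , w∉ ← fresh-common-neighbour m∈X₂ (head∈X₂ t) (x₁ ∷ h ∷ tl) (Tail-few-X₁ t)
        = w , neighbour-side m~w m∈X₂ , Tail-prepend t m∈X₂ m∉ m~w h~w w∉

      -- Members of M already on the tail are skipped, so M need not be disjoint from it.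
      absorb : ∀ {h tl t} (M : List V) → All (λ m → side m ≡ true × m ≢ t) M →
               side t ≡ true → t ∉ h ∷ tl → Tail h tl →
               ∃[ tl′ ] Tail t tl′ × h ∷ tl ⊆ t ∷ tl′ × M ⊆ t ∷ tl′
      absorb [] [] t∈X₂ t∉ T with _ , _ , T′ ← extend T t∈X₂ t∉ = _ , T′ , there ∘ there , λ ()
      absorb {h} {tl} (m ∷ M) ((m∈X₂ , m≢t) ∷ M-ok) t∈X₂ t∉ T with m ∈? (h ∷ tl)
      ... | yes m∈
        with tl′ , T′ , grows , covers ← absorb M M-ok t∈X₂ t∉ T
        = tl′ , T′ , grows , λ { (here refl) → grows m∈ ; (there m′∈) → covers m′∈ }
      ... | no m∉
        with w , w∈X₁ , Tm ← extend T m∈X₂ m∉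
        with tl′ , T′ , grows , covers ←
               absorb M M-ok t∈X₂ (∉-∷ (m≢t ∘ sym) (∉-∷ (X₂≢X₁ t∈X₂ w∈X₁) t∉)) Tm
        = tl′ , T′ , grows ∘ there ∘ there
        , λ { (here refl) → grows (here refl) ; (there m′∈) → covers m′∈ }

      X₂-except? : (y : V) → Decidable (λ v → side v ≡ true × v ≢ y)
      X₂-except? y v = X? true v ×-dec ¬? (v ≟ᶠ y)

      covering-tail : ∀ {y₁ y₂} → side y₁ ≡ true → y₁ ≢ y₂ → Adj G x₂ y₂ → x₁ ≢ x₂ →
                      ∃[ tl ] Tail y₁ tl × (∀ v → side v ≡ true → v ∈ y₁ ∷ tl)
      covering-tail {y₁} {y₂} y₁∈X₂ y₁≢y₂ x₂~y₂ x₁≢x₂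
        with tl , T , _ , covered ←
               absorb (filter (X₂-except? y₁) (allFin n)) (all-filter (X₂-except? y₁) (allFin n))
                      y₁∈X₂ (∉-∷ y₁≢y₂ (∉-∷ (X₂≢X₁ y₁∈X₂ x₂∈X₁) λ ())) (Tail-start x₂~y₂ x₁≢x₂)
        = tl , T , covers
        where
        covers : ∀ v → side v ≡ true → v ∈ y₁ ∷ tl
        covers v v∈X₂ with v ≟ᶠ y₁
        ... | yes refl = here refl
        ... | no v≢y₁  = covered (∈-filter⁺ (X₂-except? y₁) (∈-allFin v) (v∈X₂ , v≢y₁))

      X₂-covering-path : x₁ ≢ x₂ → 0 < degree G x₁ → 2 ≤ degree G x₂ →
                         ∃[ p ] IsPath G x₁ x₂ p × (∀ v → side v ≡ true → v ∈ p)
      X₂-covering-path x₁≢x₂ deg₁ deg₂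
        with y₁ , x₁~y₁ , _   ← neighbour-∉ {ys = []} deg₁
        with y₂ , x₂~y₂ , y₂∉ ← neighbour-∉ {ys = [ y₁ ]} deg₂
        with tl , T , covers  ← covering-tail (neighbour-side x₁~y₁ x₁∈X₁) (y₂∉ ∘ here ∘ sym) x₂~y₂ x₁≢x₂
        = x₁ ∷ y₁ ∷ tl , IsPath-∷ x₁~y₁ (x₁∉ T) (isPath T) , λ v v∈X₂ → there (covers v v∈X₂)

lemma6p6 : (n : ℕ) → 4 ≤ n → (G : SimpleGraph n) → (side : Fin n → Bool) →
           IsBipartition G side →
           partSize side true + 1 < partSize side false →
           (∀ v → side v ≡ true → n + 2 ≤ 2 * degree G v) →
           (x₁ x₂ : Fin n) → side x₁ ≡ false → side x₂ ≡ false → x₁ ≢ x₂ →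
           2 ≤ degree G x₁ → 2 ≤ degree G x₂ →
           Σ (List (Fin n)) (λ p → IsPath G x₁ x₂ p × (∀ v → side v ≡ true → v ∈ p))
lemma6p6 n _ G side bipartite _ dense x₁ x₂ x₁∈X₁ x₂∈X₁ x₁≢x₂ deg₁ deg₂ =
  Bipartite.X₂-covering-path G side bipartite dense x₁ x₂ x₁∈X₁ x₂∈X₁ x₁≢x₂
    (≤-trans (s≤s z≤n) deg₁) deg₂
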